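{- Let $1\leqslant k<n$ be integers and $\mathbb{Z}\Delta=\{x\in\mathbb{Z}^n : k\mid x_1+\cdots+x_n\}$. The maps $s_1,\ldots,s_{n-1},s_\beta:\mathbb{Z}\Delta\to\mathbb{Z}\Delta$ satisfy the Coxeter relations $s_\beta^2=s_1^2=\cdots=s_{n-1}^2=\mathrm{id}$; $s_is_js_i=s_js_is_j$ for $|i-j|=1$; $s_is_j=s_js_i$ for $|i-j|>1$ ($i,j\leqslant n-1$); $s_\beta s_k s_\beta=s_k s_\beta s_k$; $s_\beta s_i=s_is_\beta$ for $i\neq k$. Hence they define an action on $\mathbb{Z}\Delta$ of the Coxeter group $W(\mathsf{J}_{k,n})$ with generators $s_\beta,s_1,\ldots,s_{n-1}$ and these relations.
   Context: For $x=(x_1,\ldots,x_n)^\top\in\mathbb{Z}\Delta$, $\deg(x)=(x_1+\cdots+x_n)/k$. For $i=1,\ldots,n-1$, $s_i$ swaps the $i$-th and $(i+1)$-st coordinates of $x$. The map $s_\beta$ is $s_\beta(x)=(x_1+r,\ldots,x_k+r,x_{k+1},\ldots,x_n)^\top$ with $r=x_{k+1}+\cdots+x_n-2\deg(x)$. -}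

module Defs where

open import Data.Nat as ℕ using (ℕ; zero; suc; _<_; _<?_)
open import Data.Integer as ℤ using (ℤ; +_; _+_; _-_; _*_)
open import Data.Integer.DivMod using (_/ℕ_)
open import Data.Integer.Divisibility using (_∣_)
open import Data.Fin using (Fin; toℕ; fromℕ<) renaming (zero to fzero; suc to fsuc)
open import Data.Nat.Properties using (<-trans; n<1+n)
open import Data.Fin.Permutation.Components using (transpose)
open import Data.Bool using (if_then_else_)
open import Relation.Nullary using (does)
open import Relation.Binary.PropositionalEquality using (_≡_)

-- Vectors in ℤ^n, as functions on coordinates (0-based: coordinate j ↔ x_{j+1}).
Vecℤ : ℕ → Set
Vecℤ n = Fin n → ℤ

sumℤ : ∀ {n} → Vecℤ n → ℤ
sumℤ {zero}  x = + 0
sumℤ {suc n} x = x fzero + sumℤ (λ j → x (fsuc j))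

InZΔ : ∀ {n} (k : ℕ) → Vecℤ n → Set
InZΔ k x = + k ∣ sumℤ x

-- deg(x) = (x_1 + ... + x_n) / k   (k ≥ 1; the k = 0 case is never used)
deg : ∀ {n} (k : ℕ) → Vecℤ n → ℤ
deg zero    x = + 0
deg (suc k) x = sumℤ x /ℕ suc k

-- x_{k+1} + ... + x_n  (sum of the coordinates with 0-based index ≥ k)
tailSum : ∀ {n} (k : ℕ) → Vecℤ n → ℤ
tailSum k x = sumℤ (λ j → if does (toℕ j <? k) then + 0 else x j)

-- s_i (1 ≤ i ≤ n-1) swaps the i-th and (i+1)-st coordinates,
-- i.e. the 0-based coordinates i-1 and i.
s : ∀ {n} (i : ℕ) → 1 ℕ.≤ i → i < n → Vecℤ n → Vecℤ n
s zero () i<n x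
s (suc i) _ i<n x =
  λ j → x (transpose (fromℕ< {i} (<-trans (n<1+n i) i<n)) (fromℕ< i<n) j)

sβ : ∀ {n} (k : ℕ) → Vecℤ n → Vecℤ n
sβ k x j = if does (toℕ j <? k) then x j + r else x j
  where r = tailSum k x - + 2 * deg k x

_≈_ : ∀ {n} → Vecℤ n → Vecℤ n → Set
x ≈ y = ∀ j → x j ≡ y j
infix 4 _≈_

-- The s_i permute coordinates, so they preserve the coordinate sum and inherit
-- the Coxeter relations of the adjacent transpositions of ℕ.  The map s_β adds
-- r(x) = x_{k+1} + ... + x_n - 2 deg(x) to the first k coordinates: it keeps
-- the tail sum and, on ℤΔ, raises the degree by r(x), whence r(s_β x) = -r(x)
-- and s_β² = id.  For i ≠ k, s_i keeps the head and the tail, hence r, so it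
-- commutes with s_β.  For s_k one has r(s_k y) = r(y) - y_{k+1} + y_k, and the
-- braid relation is then checked on the coordinates k, k+1, the other head
-- coordinates and the other tail coordinates separately.

module Submission where

open import Data.Bool using (if_then_else_)
open import Data.Empty using (⊥-elim)
open import Data.Fin using (Fin; toℕ; fromℕ<; punchIn) renaming (zero to fzero; suc to fsuc)
import Data.Fin.Permutation as Perm
open import Data.Fin.Permutation.Components using (transpose)
open import Data.Fin.Properties using (_≟_; toℕ-fromℕ<; toℕ-injective; punchInᵢ≢i)
open import Data.Integer as ℤ using (ℤ; +_; -[1+_]; _+_; _-_; _*_; -_)
open import Data.Integer.DivMod using (_/ℕ_)
open import Data.Integer.Divisibility using (_∣_)
open import Data.Integer.Divisibility.Signed using (divides; ∣ᵤ⇒∣; ∣⇒∣ᵤ; ∣-refl; ∣m∣n⇒∣m+n; ∣m⇒∣m*n)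
import Data.Integer.Properties as ℤ
open import Algebra.Properties.CommutativeMonoid.Sum ℤ.+-0-commutativeMonoid
  using (sum; sum-cong-≗; sum-permute; sum-remove)
open import Data.Integer.Tactic.RingSolver using (solve-∀)
open import Data.Nat as ℕ using (ℕ; zero; suc; NonZero; _≤_; _<_; _<?_; ∣_-_∣; s≤s)
open import Data.Nat.DivMod using (m*n/n≡m; m*n%n≡0)
import Data.Nat.Properties as ℕ
open import Data.Product using (_×_; _,_)
open import Defs
open import Function using (_∘_)
open import Relation.Nullary using (does; yes; no)
open import Relation.Nullary.Decidable using (dec-true; dec-false)
open import Relation.Binary.PropositionalEquality

-- Adjacent transpositions of ℕ

swapAdj : ℕ → ℕ → ℕ
swapAdj zero    zero          = 1
swapAdj zero    (suc zero)    = 0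
swapAdj zero    (suc (suc m)) = suc (suc m)
swapAdj (suc a) zero          = zero
swapAdj (suc a) (suc m)       = suc (swapAdj a m)

swapAdj-self : ∀ a → swapAdj a a ≡ suc a
swapAdj-self zero    = refl
swapAdj-self (suc a) = cong suc (swapAdj-self a)

swapAdj-suc : ∀ a → swapAdj a (suc a) ≡ a
swapAdj-suc zero    = refl
swapAdj-suc (suc a) = cong suc (swapAdj-suc a)

swapAdj-other : ∀ a m → m ≢ a → m ≢ suc a → swapAdj a m ≡ m
swapAdj-other zero    zero          m≢a _     = ⊥-elim (m≢a refl)
swapAdj-other zero    (suc zero)    _   m≢1+a = ⊥-elim (m≢1+a refl)
swapAdj-other zero    (suc (suc m)) _   _     = refl
swapAdj-other (suc a) zero          _   _     = refl
swapAdj-other (suc a) (suc m)       m≢a m≢1+a = cong suc (swapAdj-other a m (m≢a ∘ cong suc) (m≢1+a ∘ cong suc))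

swapAdj-involutive : ∀ a m → swapAdj a (swapAdj a m) ≡ m
swapAdj-involutive zero    zero          = refl
swapAdj-involutive zero    (suc zero)    = refl
swapAdj-involutive zero    (suc (suc m)) = refl
swapAdj-involutive (suc a) zero          = refl
swapAdj-involutive (suc a) (suc m)       = cong suc (swapAdj-involutive a m)

swapAdj-braid : ∀ a b → ∣ a - b ∣ ≡ 1 → ∀ m →
  swapAdj a (swapAdj b (swapAdj a m)) ≡ swapAdj b (swapAdj a (swapAdj b m))
swapAdj-braid zero          zero          ()
swapAdj-braid zero          (suc zero)    _ zero                = refl
swapAdj-braid zero          (suc zero)    _ (suc zero)          = refl
swapAdj-braid zero          (suc zero)    _ (suc (suc zero))    = refl
swapAdj-braid zero          (suc zero)    _ (suc (suc (suc m))) = refl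
swapAdj-braid zero          (suc (suc b)) ()
swapAdj-braid (suc zero)    zero          _ zero                = refl
swapAdj-braid (suc zero)    zero          _ (suc zero)          = refl
swapAdj-braid (suc zero)    zero          _ (suc (suc zero))    = refl
swapAdj-braid (suc zero)    zero          _ (suc (suc (suc m))) = refl
swapAdj-braid (suc (suc a)) zero          ()
swapAdj-braid (suc a)       (suc b)       _ zero                = refl
swapAdj-braid (suc a)       (suc b)       h (suc m)             = cong suc (swapAdj-braid a b h m)

swapAdj-comm : ∀ a b → 1 < ∣ a - b ∣ → ∀ m → swapAdj a (swapAdj b m) ≡ swapAdj b (swapAdj a m)
swapAdj-comm zero          zero          ()
swapAdj-comm zero          (suc zero)    (s≤s ())
swapAdj-comm zero          (suc (suc b)) _ zero          = refl
swapAdj-comm zero          (suc (suc b)) _ (suc zero)    = refl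
swapAdj-comm zero          (suc (suc b)) _ (suc (suc m)) = refl
swapAdj-comm (suc zero)    zero          (s≤s ())
swapAdj-comm (suc (suc a)) zero          _ zero          = refl
swapAdj-comm (suc (suc a)) zero          _ (suc zero)    = refl
swapAdj-comm (suc (suc a)) zero          _ (suc (suc m)) = refl
swapAdj-comm (suc a)       (suc b)       _ zero          = refl
swapAdj-comm (suc a)       (suc b)       h (suc m)       = cong suc (swapAdj-comm a b h m)

swapAdj-<? : ∀ a m k → suc a ≢ k → does (swapAdj a m <? k) ≡ does (m <? k)
swapAdj-<? zero    zero          zero          _ = refl
swapAdj-<? zero    zero          (suc zero)    h = ⊥-elim (h refl)
swapAdj-<? zero    zero          (suc (suc k)) _ = refl
swapAdj-<? zero    (suc zero)    zero          _ = refl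
swapAdj-<? zero    (suc zero)    (suc zero)    h = ⊥-elim (h refl)
swapAdj-<? zero    (suc zero)    (suc (suc k)) _ = refl
swapAdj-<? zero    (suc (suc m)) k             _ = refl
swapAdj-<? (suc a) zero          k             _ = refl
swapAdj-<? (suc a) (suc m)       zero          _ = refl
swapAdj-<? (suc a) (suc m)       (suc k)       h = swapAdj-<? a m k (h ∘ cong suc)

-- s (suc a) x is definitionally x ∘ Adjacent.swap a _, the transposition of coordinates a and a + 1.

module Adjacent {n} (a : ℕ) (hn : suc a < n) where

  lower upper : Fin n
  lower = fromℕ< (ℕ.<-trans (ℕ.n<1+n a) hn)
  upper = fromℕ< hn

  toℕ-lower : toℕ lower ≡ a
  toℕ-lower = toℕ-fromℕ< _

  toℕ-upper : toℕ upper ≡ suc a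
  toℕ-upper = toℕ-fromℕ< hn

  swap : Fin n → Fin n
  swap = transpose lower upper

  lower≢upper : lower ≢ upper
  lower≢upper e = ℕ.1+n≢n (trans (sym toℕ-upper) (trans (cong toℕ (sym e)) toℕ-lower))

  swap-lower : swap lower ≡ upper
  swap-lower rewrite dec-true (lower ≟ lower) refl = refl

  swap-upper : swap upper ≡ lower
  swap-upper rewrite dec-false (upper ≟ lower) (lower≢upper ∘ sym) | dec-true (upper ≟ upper) refl = refl

  swap-fixes : ∀ {j} → j ≢ lower → j ≢ upper → swap j ≡ j
  swap-fixes {j} j≢l j≢u rewrite dec-false (j ≟ lower) j≢l | dec-false (j ≟ upper) j≢u = refl

  by-position : (P : Fin n → Set) → P lower → P upper → (∀ j → j ≢ lower → j ≢ upper → P j) → ∀ j → P j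
  by-position P p-lower p-upper p-other j with j ≟ lower | j ≟ upper
  ... | yes refl | _        = p-lower
  ... | no _     | yes refl = p-upper
  ... | no j≢l   | no j≢u   = p-other j j≢l j≢u

  toℕ-swap : ∀ j → toℕ (swap j) ≡ swapAdj a (toℕ j)
  toℕ-swap = by-position (λ j → toℕ (swap j) ≡ swapAdj a (toℕ j))
    (begin
      toℕ (swap lower)       ≡⟨ cong toℕ swap-lower ⟩
      toℕ upper              ≡⟨ toℕ-upper ⟩
      suc a                  ≡⟨ swapAdj-self a ⟨
      swapAdj a a            ≡⟨ cong (swapAdj a) toℕ-lower ⟨
      swapAdj a (toℕ lower)  ∎)
    (begin
      toℕ (swap upper)       ≡⟨ cong toℕ swap-upper ⟩
      toℕ lower              ≡⟨ toℕ-lower ⟩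
      a                      ≡⟨ swapAdj-suc a ⟨
      swapAdj a (suc a)      ≡⟨ cong (swapAdj a) toℕ-upper ⟨
      swapAdj a (toℕ upper)  ∎)
    (λ j j≢l j≢u → trans (cong toℕ (swap-fixes j≢l j≢u)) (sym (swapAdj-other a (toℕ j)
      (λ e → j≢l (toℕ-injective (trans e (sym toℕ-lower))))
      (λ e → j≢u (toℕ-injective (trans e (sym toℕ-upper)))))))
    where open ≡-Reasoning

  lower-<-1+a : toℕ lower < suc a
  lower-<-1+a = ℕ.≤-reflexive (cong suc toℕ-lower)

  1+a-≤-upper : suc a ≤ toℕ upper
  1+a-≤-upper = ℕ.≤-reflexive (sym toℕ-upper)

  swap-<? : ∀ {k} → suc a ≢ k → ∀ j → does (toℕ (swap j) <? k) ≡ does (toℕ j <? k)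
  swap-<? {k} 1+a≢k j = trans (cong (λ m → does (m <? k)) (toℕ-swap j)) (swapAdj-<? a (toℕ j) k 1+a≢k)

-- Coordinate sums and the degree

sumℤ≡sum : ∀ {n} (x : Vecℤ n) → sumℤ x ≡ sum x
sumℤ≡sum {zero}  x = refl
sumℤ≡sum {suc n} x = cong (_+_ (x fzero)) (sumℤ≡sum (x ∘ fsuc))

sumℤ-cong : ∀ {n} {x y : Vecℤ n} → x ≈ y → sumℤ x ≡ sumℤ y
sumℤ-cong {zero}  x≈y = refl
sumℤ-cong {suc n} x≈y = cong₂ _+_ (x≈y fzero) (sumℤ-cong (x≈y ∘ fsuc))

sumℤ-transpose : ∀ {n} (i j : Fin n) (x : Vecℤ n) → sumℤ (x ∘ transpose i j) ≡ sumℤ x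
sumℤ-transpose i j x = begin
  sumℤ (x ∘ transpose i j)  ≡⟨ sumℤ≡sum (x ∘ transpose i j) ⟩
  sum (x ∘ transpose i j)   ≡⟨ sum-permute x (Perm.transpose i j) ⟨
  sum x                     ≡⟨ sumℤ≡sum x ⟨
  sumℤ x                    ∎
  where open ≡-Reasoning

sumℤ-update : ∀ {n} (p : Fin n) {x y : Vecℤ n} → (∀ j → j ≢ p → y j ≡ x j) →
  sumℤ y ≡ sumℤ x - x p + y p
sumℤ-update {suc n} p {x} {y} y≈x = begin
  sumℤ y                               ≡⟨ sumℤ≡sum y ⟩
  sum y                                ≡⟨ sum-remove y ⟩
  y p + sum (y ∘ punchIn p)            ≡⟨ cong (_+_ (y p)) (sum-cong-≗ (λ j → y≈x (punchIn p j) (punchInᵢ≢i p j))) ⟩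
  y p + sum (x ∘ punchIn p)            ≡⟨ rearrange (y p) (x p) (sum (x ∘ punchIn p)) ⟩
  x p + sum (x ∘ punchIn p) - x p + y p ≡⟨ cong (λ t → t - x p + y p) (sum-remove x) ⟨
  sum x - x p + y p                    ≡⟨ cong (λ t → t - x p + y p) (sumℤ≡sum x) ⟨
  sumℤ x - x p + y p                   ∎
  where
  open ≡-Reasoning
  rearrange : ∀ a b s → a + s ≡ b + s - b + a
  rearrange = solve-∀

sumℤ-addHead : ∀ {n} k → k ≤ n → (c : ℤ) (x : Vecℤ n) →
  sumℤ (λ j → if does (toℕ j <? k) then x j + c else x j) ≡ sumℤ x + + k * c
sumℤ-addHead zero    _         c x = sym (trans (cong (_+_ (sumℤ x)) (ℤ.*-zeroˡ c)) (ℤ.+-identityʳ (sumℤ x)))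
sumℤ-addHead (suc k) (s≤s k≤n) c x = begin
  x fzero + c + sumℤ (λ j → if does (toℕ j <? k) then x (fsuc j) + c else x (fsuc j))
    ≡⟨ cong (_+_ (x fzero + c)) (sumℤ-addHead k k≤n c (x ∘ fsuc)) ⟩
  x fzero + c + (sumℤ (x ∘ fsuc) + + k * c)
    ≡⟨ regroup (x fzero) (sumℤ (x ∘ fsuc)) (+ k) c ⟩
  x fzero + sumℤ (x ∘ fsuc) + (+ 1 + + k) * c
    ∎
  where
  open ≡-Reasoning
  regroup : ∀ a s k c → a + c + (s + k * c) ≡ a + s + (+ 1 + k) * c
  regroup = solve-∀

-- On negative dividends _/ℕ_ branches on whether the remainder vanishes.
i*d/ℕd≡i : ∀ i d .{{_ : NonZero d}} → (i * + d) /ℕ d ≡ i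
i*d/ℕd≡i (+ q) d = begin
  (+ q * + d) /ℕ d   ≡⟨ cong (_/ℕ d) (ℤ.pos-* q d) ⟨
  + (q ℕ.* d ℕ./ d)  ≡⟨ cong +_ (m*n/n≡m q d) ⟩
  + q                ∎
  where open ≡-Reasoning
i*d/ℕd≡i -[1+ q ] d@(suc _) with suc q ℕ.* d ℕ.% d | m*n%n≡0 (suc q) d
... | .zero | refl = cong (-_ ∘ +_) (m*n/n≡m (suc q) d)

deg-exact : ∀ {n} k .{{_ : NonZero k}} {x : Vecℤ n} {w} → sumℤ x ≡ w * + k → deg k x ≡ w
deg-exact (suc k) {w = w} sx≡wk = trans (cong (_/ℕ suc k) sx≡wk) (i*d/ℕd≡i w (suc k))

deg-cong : ∀ {n} k {x y : Vecℤ n} → sumℤ x ≡ sumℤ y → deg k x ≡ deg k y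
deg-cong zero    _  = refl
deg-cong (suc k) sx≡sy = cong (_/ℕ suc k) sx≡sy

-- The maps s_i

toℕ-swap² : ∀ {n} a b (ha : suc a < n) (hb : suc b < n) j →
  toℕ (Adjacent.swap a ha (Adjacent.swap b hb j)) ≡ swapAdj a (swapAdj b (toℕ j))
toℕ-swap² a b ha hb j =
  trans (Adjacent.toℕ-swap a ha _) (cong (swapAdj a) (Adjacent.toℕ-swap b hb j))

sumℤ-s : ∀ {n} i hi (hn : i < n) (x : Vecℤ n) → sumℤ (s i hi hn x) ≡ sumℤ x
sumℤ-s (suc a) _ hn = sumℤ-transpose (Adjacent.lower a hn) (Adjacent.upper a hn)

s-preserves-ZΔ : ∀ {n} k i hi (hn : i < n) {x : Vecℤ n} → InZΔ k x → InZΔ k (s i hi hn x)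
s-preserves-ZΔ k i hi hn {x} = subst (+ k ∣_) (sym (sumℤ-s i hi hn x))

s-involutive : ∀ {n} i hi (hn : i < n) (x : Vecℤ n) → s i hi hn (s i hi hn x) ≈ x
s-involutive (suc a) _ hn x j = cong x (toℕ-injective
  (trans (toℕ-swap² a a hn hn j) (swapAdj-involutive a (toℕ j))))

s-braid : ∀ {n} i j hi (hin : i < n) hj (hjn : j < n) → ∣ i - j ∣ ≡ 1 → (x : Vecℤ n) →
  s i hi hin (s j hj hjn (s i hi hin x)) ≈ s j hj hjn (s i hi hin (s j hj hjn x))
s-braid (suc a) (suc b) _ ha _ hb ∣a-b∣≡1 x m = cong x (toℕ-injective (begin
  toℕ (swapA (swapB (swapA m)))                 ≡⟨ Adjacent.toℕ-swap a ha _ ⟩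
  swapAdj a (toℕ (swapB (swapA m)))             ≡⟨ cong (swapAdj a) (toℕ-swap² b a hb ha m) ⟩
  swapAdj a (swapAdj b (swapAdj a (toℕ m)))     ≡⟨ swapAdj-braid a b ∣a-b∣≡1 (toℕ m) ⟩
  swapAdj b (swapAdj a (swapAdj b (toℕ m)))     ≡⟨ cong (swapAdj b) (toℕ-swap² a b ha hb m) ⟨
  swapAdj b (toℕ (swapA (swapB m)))             ≡⟨ Adjacent.toℕ-swap b hb _ ⟨
  toℕ (swapB (swapA (swapB m)))                 ∎))
  where
  open ≡-Reasoning
  swapA = Adjacent.swap a ha
  swapB = Adjacent.swap b hb

s-comm : ∀ {n} i j hi (hin : i < n) hj (hjn : j < n) → 1 < ∣ i - j ∣ → (x : Vecℤ n) →
  s i hi hin (s j hj hjn x) ≈ s j hj hjn (s i hi hin x)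
s-comm (suc a) (suc b) _ ha _ hb 1<∣a-b∣ x m = cong x (toℕ-injective (begin
  toℕ (Adjacent.swap b hb (Adjacent.swap a ha m))  ≡⟨ toℕ-swap² b a hb ha m ⟩
  swapAdj b (swapAdj a (toℕ m))                    ≡⟨ swapAdj-comm a b 1<∣a-b∣ (toℕ m) ⟨
  swapAdj a (swapAdj b (toℕ m))                    ≡⟨ toℕ-swap² a b ha hb m ⟨
  toℕ (Adjacent.swap a ha (Adjacent.swap b hb m))  ∎))
  where open ≡-Reasoning

-- The map s_β

shift : ∀ {n} → ℕ → Vecℤ n → ℤ
shift k x = tailSum k x - + 2 * deg k x

-- tailSum k x unfolds to sumℤ (tailPart k x).
tailPart : ∀ {n} → ℕ → Vecℤ n → Vecℤ n
tailPart k x j = if does (toℕ j <? k) then + 0 else x j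

tailPart-tail : ∀ {n} k (x : Vecℤ n) {j} → k ≤ toℕ j → tailPart k x j ≡ x j
tailPart-tail k x {j} k≤j rewrite dec-false (toℕ j <? k) (ℕ.≤⇒≯ k≤j) = refl

tailPart-cong : ∀ {n} k (x y : Vecℤ n) j → (k ≤ toℕ j → x j ≡ y j) → tailPart k x j ≡ tailPart k y j
tailPart-cong k x y j x≡y with toℕ j <? k
... | yes j<k rewrite dec-true (toℕ j <? k) j<k = refl
... | no j≮k rewrite dec-false (toℕ j <? k) j≮k = x≡y (ℕ.≮⇒≥ j≮k)

sβ-head : ∀ {n} k (x : Vecℤ n) {j} → toℕ j < k → sβ k x j ≡ x j + shift k x
sβ-head k x {j} j<k rewrite dec-true (toℕ j <? k) j<k = refl

sβ-tail : ∀ {n} k (x : Vecℤ n) {j} → k ≤ toℕ j → sβ k x j ≡ x j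
sβ-tail k x {j} k≤j rewrite dec-false (toℕ j <? k) (ℕ.≤⇒≯ k≤j) = refl

tailSum-sβ : ∀ {n} k (x : Vecℤ n) → tailSum k (sβ k x) ≡ tailSum k x
tailSum-sβ k x = sumℤ-cong (λ j → tailPart-cong k (sβ k x) x j (sβ-tail k x))

sumℤ-sβ : ∀ {n} k → k ≤ n → (x : Vecℤ n) → sumℤ (sβ k x) ≡ sumℤ x + + k * shift k x
sumℤ-sβ k k≤n x = sumℤ-addHead k k≤n (shift k x) x

sβ-preserves-ZΔ : ∀ {n} k → k ≤ n → {x : Vecℤ n} → InZΔ k x → InZΔ k (sβ k x)
sβ-preserves-ZΔ k k≤n {x} x∈ZΔ = subst (+ k ∣_) (sym (sumℤ-sβ k k≤n x))
  (∣⇒∣ᵤ (∣m∣n⇒∣m+n (∣ᵤ⇒∣ {+ k} {sumℤ x} x∈ZΔ) (∣m⇒∣m*n (shift k x) ∣-refl)))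

deg-sβ : ∀ {n} k .{{_ : NonZero k}} → k ≤ n → {x : Vecℤ n} → InZΔ k x →
  deg k (sβ k x) ≡ deg k x + shift k x
deg-sβ k k≤n {x} x∈ZΔ with ∣ᵤ⇒∣ {+ k} {sumℤ x} x∈ZΔ
... | divides w sx≡wk = begin
  deg k (sβ k x)    ≡⟨ deg-exact k sβx≡[w+r]k ⟩
  w + shift k x     ≡⟨ cong (_+ shift k x) (deg-exact k {w = w} sx≡wk) ⟨
  deg k x + shift k x ∎
  where
  open ≡-Reasoning
  factor : ∀ w k r → w * k + k * r ≡ (w + r) * k
  factor = solve-∀
  sβx≡[w+r]k : sumℤ (sβ k x) ≡ (w + shift k x) * + k
  sβx≡[w+r]k = trans (sumℤ-sβ k k≤n x)
    (trans (cong (_+ + k * shift k x) sx≡wk) (factor w (+ k) (shift k x)))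

shift-sβ : ∀ {n} k .{{_ : NonZero k}} → k ≤ n → {x : Vecℤ n} → InZΔ k x →
  shift k (sβ k x) ≡ - shift k x
shift-sβ k k≤n {x} x∈ZΔ = begin
  tailSum k (sβ k x) - + 2 * deg k (sβ k x)
    ≡⟨ cong₂ (λ t d → t - + 2 * d) (tailSum-sβ k x) (deg-sβ k k≤n x∈ZΔ) ⟩
  tailSum k x - + 2 * (deg k x + (tailSum k x - + 2 * deg k x))
    ≡⟨ negate (tailSum k x) (deg k x) ⟩
  - (tailSum k x - + 2 * deg k x)
    ∎
  where
  open ≡-Reasoning
  negate : ∀ t d → t - + 2 * (d + (t - + 2 * d)) ≡ - (t - + 2 * d)
  negate = solve-∀

sβ-involutive : ∀ {n} k .{{_ : NonZero k}} → k ≤ n → {x : Vecℤ n} → InZΔ k x → sβ k (sβ k x) ≈ x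
sβ-involutive k k≤n {x} x∈ZΔ j with toℕ j <? k
... | no j≮k = trans (sβ-tail k (sβ k x) (ℕ.≮⇒≥ j≮k)) (sβ-tail k x (ℕ.≮⇒≥ j≮k))
... | yes j<k = begin
  sβ k (sβ k x) j                  ≡⟨ sβ-head k (sβ k x) j<k ⟩
  sβ k x j + shift k (sβ k x)      ≡⟨ cong₂ _+_ (sβ-head k x j<k) (shift-sβ k k≤n x∈ZΔ) ⟩
  x j + shift k x + - shift k x    ≡⟨ cancel (x j) (shift k x) ⟩
  x j                              ∎
  where
  open ≡-Reasoning
  cancel : ∀ a r → a + r + - r ≡ a
  cancel = solve-∀

tailSum-s : ∀ {n} k i hi (hn : i < n) → i ≢ k → (x : Vecℤ n) → tailSum k (s i hi hn x) ≡ tailSum k x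
tailSum-s k (suc a) _ hn 1+a≢k x =
  trans (sumℤ-cong tailPart-swap) (sumℤ-transpose lower upper (tailPart k x))
  where
  open Adjacent a hn
  tailPart-swap : ∀ j → tailPart k (x ∘ swap) j ≡ tailPart k x (swap j)
  tailPart-swap j = cong (λ b → if b then + 0 else x (swap j)) (sym (swap-<? 1+a≢k j))

shift-s : ∀ {n} k i hi (hn : i < n) → i ≢ k → (x : Vecℤ n) → shift k (s i hi hn x) ≡ shift k x
shift-s k i hi hn i≢k x =
  cong₂ (λ t d → t - + 2 * d) (tailSum-s k i hi hn i≢k x) (deg-cong k (sumℤ-s i hi hn x))

sβ-s-comm : ∀ {n} k i hi (hn : i < n) → i ≢ k → (x : Vecℤ n) → sβ k (s i hi hn x) ≈ s i hi hn (sβ k x)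
sβ-s-comm k (suc a) hi hn 1+a≢k x j =
  trans (cong (λ r → if does (toℕ j <? k) then x (swap j) + r else x (swap j)) (shift-s k (suc a) hi hn 1+a≢k x))
        (cong (λ b → if b then x (swap j) + shift k x else x (swap j)) (sym (swap-<? 1+a≢k j)))
  where open Adjacent a hn

-- The braid relation between s_β and s_k

module _ {n} (a : ℕ) (hk : 1 ≤ suc a) (hn : suc a < n) where
  open Adjacent a hn

  private
    K : ℕ
    K = suc a

    sK : Vecℤ n → Vecℤ n
    sK = s K hk hn

  tailSum-s-boundary : (y : Vecℤ n) → tailSum K (sK y) ≡ tailSum K y - y upper + y lower
  tailSum-s-boundary y = begin
    tailSum K (sK y)
      ≡⟨ sumℤ-update upper {tailPart K y} {tailPart K (sK y)} agree-off-upper ⟩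
    tailSum K y - tailPart K y upper + tailPart K (sK y) upper
      ≡⟨ cong₂ (λ b c → tailSum K y - b + c) (tailPart-tail K y 1+a-≤-upper)
               (trans (tailPart-tail K (sK y) 1+a-≤-upper) (cong y swap-upper)) ⟩
    tailSum K y - y upper + y lower
      ∎
    where
    open ≡-Reasoning
    j≢lower : ∀ {j} → K ≤ toℕ j → j ≢ lower
    j≢lower K≤j refl = ℕ.<⇒≱ lower-<-1+a K≤j
    agree-off-upper : ∀ j → j ≢ upper → tailPart K (sK y) j ≡ tailPart K y j
    agree-off-upper j j≢u = tailPart-cong K (sK y) y j (λ K≤j → cong y (swap-fixes (j≢lower K≤j) j≢u))

  shift-s-boundary : (y : Vecℤ n) → shift K (sK y) ≡ shift K y - y upper + y lower
  shift-s-boundary y = begin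
    tailSum K (sK y) - + 2 * deg K (sK y)
      ≡⟨ cong₂ (λ t d → t - + 2 * d) (tailSum-s-boundary y) (deg-cong K {sK y} (sumℤ-s K hk hn y)) ⟩
    tailSum K y - y upper + y lower - + 2 * deg K y
      ≡⟨ regroup (tailSum K y) (y upper) (y lower) (deg K y) ⟩
    tailSum K y - + 2 * deg K y - y upper + y lower
      ∎
    where
    open ≡-Reasoning
    regroup : ∀ t b c d → t - b + c - + 2 * d ≡ t - + 2 * d - b + c
    regroup = solve-∀

  sβ-s-braid : (x : Vecℤ n) → InZΔ K x → sβ K (sK (sβ K x)) ≈ sK (sβ K (sK x))
  sβ-s-braid x x∈ZΔ = by-position (λ j → sβ K z j ≡ v (swap j)) at-lower at-upper elsewhere
    where
    open ≡-Reasoning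
    K≤n : K ≤ n
    K≤n = ℕ.<⇒≤ hn
    r A B : ℤ
    r = shift K x
    A = x lower
    B = x upper
    y z u v : Vecℤ n
    y = sβ K x
    z = sK y
    u = sK x
    v = sβ K u

    shift-z : shift K z ≡ - r - B + (A + r)
    shift-z = begin
      shift K (sK y)                   ≡⟨ shift-s-boundary y ⟩
      shift K y - y upper + y lower    ≡⟨ cong₂ (λ b c → shift K y - b + c)
                                          (sβ-tail K x 1+a-≤-upper) (sβ-head K x lower-<-1+a) ⟩
      shift K y - B + (A + r)          ≡⟨ cong (λ t → t - B + (A + r)) (shift-sβ K K≤n x∈ZΔ) ⟩
      - r - B + (A + r)                ∎

    at-lower : sβ K z lower ≡ v (swap lower)
    at-lower = begin
      sβ K z lower             ≡⟨ sβ-head K z lower-<-1+a ⟩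
      z lower + shift K z      ≡⟨ cong₂ _+_ (trans (cong y swap-lower) (sβ-tail K x 1+a-≤-upper)) shift-z ⟩
      B + (- r - B + (A + r))  ≡⟨ cancel B A r ⟩
      A                        ≡⟨ cong x swap-upper ⟨
      u upper                  ≡⟨ sβ-tail K u 1+a-≤-upper ⟨
      v upper                  ≡⟨ cong v swap-lower ⟨
      v (swap lower)           ∎
      where
      cancel : ∀ b a r → b + (- r - b + (a + r)) ≡ a
      cancel = solve-∀

    at-upper : sβ K z upper ≡ v (swap upper)
    at-upper = begin
      sβ K z upper             ≡⟨ sβ-tail K z 1+a-≤-upper ⟩
      y (swap upper)           ≡⟨ cong y swap-upper ⟩
      y lower                  ≡⟨ sβ-head K x lower-<-1+a ⟩
      A + r                    ≡⟨ regroup A B r ⟩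
      B + (r - B + A)          ≡⟨ cong₂ _+_ (cong x swap-lower) (shift-s-boundary x) ⟨
      u lower + shift K u      ≡⟨ sβ-head K u lower-<-1+a ⟨
      v lower                  ≡⟨ cong v swap-upper ⟨
      v (swap upper)           ∎
      where
      regroup : ∀ a b r → a + r ≡ b + (r - b + a)
      regroup = solve-∀

    elsewhere : ∀ j → j ≢ lower → j ≢ upper → sβ K z j ≡ v (swap j)
    elsewhere j j≢l j≢u with toℕ j <? K
    ... | yes j<K = begin
      sβ K z j                       ≡⟨ sβ-head K z j<K ⟩
      y (swap j) + shift K z         ≡⟨ cong₂ _+_ (cong y (swap-fixes j≢l j≢u)) shift-z ⟩
      y j + (- r - B + (A + r))      ≡⟨ cong (_+ (- r - B + (A + r))) (sβ-head K x j<K) ⟩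
      x j + r + (- r - B + (A + r))  ≡⟨ regroup (x j) A B r ⟩
      x j + (r - B + A)              ≡⟨ cong₂ _+_ (cong x (swap-fixes j≢l j≢u)) (shift-s-boundary x) ⟨
      u j + shift K u                ≡⟨ sβ-head K u j<K ⟨
      v j                            ≡⟨ cong v (swap-fixes j≢l j≢u) ⟨
      v (swap j)                     ∎
      where
      regroup : ∀ c a b r → c + r + (- r - b + (a + r)) ≡ c + (r - b + a)
      regroup = solve-∀
    ... | no j≮K = begin
      sβ K z j    ≡⟨ sβ-tail K z K≤j ⟩
      y (swap j)  ≡⟨ cong y (swap-fixes j≢l j≢u) ⟩
      y j         ≡⟨ sβ-tail K x K≤j ⟩
      x j         ≡⟨ cong x (swap-fixes j≢l j≢u) ⟨
      u j         ≡⟨ sβ-tail K u K≤j ⟨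
      v j         ≡⟨ cong v (swap-fixes j≢l j≢u) ⟨
      v (swap j)  ∎
      where
      K≤j : K ≤ toℕ j
      K≤j = ℕ.≮⇒≥ j≮K

lemma2p1 : (n k : ℕ) → (hk : 1 ≤ k) → (k<n : k < n) →
    -- the maps preserve ℤΔ
    ((i : ℕ) (hi : 1 ≤ i) (hn : i < n) (x : Vecℤ n) → InZΔ k x → InZΔ k (s i hi hn x))
  × ((x : Vecℤ n) → InZΔ k x → InZΔ k (sβ k x))
    -- s_β² = id
  × ((x : Vecℤ n) → InZΔ k x → sβ k (sβ k x) ≈ x)
    -- s_i² = id
  × ((i : ℕ) (hi : 1 ≤ i) (hn : i < n) (x : Vecℤ n) → InZΔ k x →
       s i hi hn (s i hi hn x) ≈ x)
    -- s_i s_j s_i = s_j s_i s_j for |i - j| = 1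
  × ((i j : ℕ) (hi : 1 ≤ i) (hin : i < n) (hj : 1 ≤ j) (hjn : j < n) →
       ∣ i - j ∣ ≡ 1 → (x : Vecℤ n) → InZΔ k x →
       s i hi hin (s j hj hjn (s i hi hin x)) ≈ s j hj hjn (s i hi hin (s j hj hjn x)))
    -- s_i s_j = s_j s_i for |i - j| > 1
  × ((i j : ℕ) (hi : 1 ≤ i) (hin : i < n) (hj : 1 ≤ j) (hjn : j < n) →
       1 < ∣ i - j ∣ → (x : Vecℤ n) → InZΔ k x →
       s i hi hin (s j hj hjn x) ≈ s j hj hjn (s i hi hin x))
    -- s_β s_k s_β = s_k s_β s_k
  × ((x : Vecℤ n) → InZΔ k x →
       sβ k (s k hk k<n (sβ k x)) ≈ s k hk k<n (sβ k (s k hk k<n x)))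
    -- s_β s_i = s_i s_β for i ≠ k
  × ((i : ℕ) (hi : 1 ≤ i) (hn : i < n) → i ≢ k → (x : Vecℤ n) → InZΔ k x →
       sβ k (s i hi hn x) ≈ s i hi hn (sβ k x))
lemma2p1 n k@(suc a) hk k<n =
    (λ i hi hn x → s-preserves-ZΔ k i hi hn)
  , (λ x → sβ-preserves-ZΔ k k≤n)
  , (λ x → sβ-involutive k k≤n)
  , (λ i hi hn x _ → s-involutive i hi hn x)
  , (λ i j hi hin hj hjn ∣i-j∣≡1 x _ → s-braid i j hi hin hj hjn ∣i-j∣≡1 x)
  , (λ i j hi hin hj hjn 1<∣i-j∣ x _ → s-comm i j hi hin hj hjn 1<∣i-j∣ x)
  , sβ-s-braid a hk k<n
  , (λ i hi hn i≢k x _ → sβ-s-comm k i hi hn i≢k x)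
  where
  k≤n : k ≤ n
  k≤n = ℕ.<⇒≤ k<n
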